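{- Let $\mathsf{M}$ be any lambda term. Then the density, among all lambda terms, of the terms that have $\mathsf{M}$ as a subterm is $1$.
   Context: Lambda terms in de Bruijn notation: $M ::= \underline{0} \mid S\,n \mid \lambda M \mid M\,M$ with de Bruijn indices $n ::= \underline{0}\mid S\,n$ (not necessarily closed). Size: $|\underline{0}|=1$, $|S\,n|=|n|+1$, $|\lambda M|=|M|+1$, $|M_1M_2|=|M_1|+|M_2|+1$. A term $N$ has $\mathsf{M}$ as a subterm if $N=\mathsf{M}$, or $N=\lambda N_1$ and $N_1$ has $\mathsf{M}$ as a subterm, or $N=N_1N_2$ and $N_1$ or $N_2$ has $\mathsf{M}$ as a subterm. The density of a set $\mathcal{A}$ of terms among all terms is $\lim_{n\to\infty}A_n/L_n$, with $A_n$ the number of elements of $\mathcal{A}$ of size $n$ and $L_n$ the number of all terms of size $n$. -}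

module Defs where

open import Data.Nat using (ℕ; zero; suc; _+_; _*_; _∸_; _≤_; _<_)
open import Data.Fin using (Fin; fromℕ; opposite)
open import Data.List using (List; []; _∷_; _++_; map; concatMap; length; filter; allFin)
open import Data.Vec using (Vec; _∷ʳ_; lookup) renaming ([] to []v; _∷_ to _∷v_)
open import Relation.Nullary using (Dec; yes; no; ¬_)
open import Relation.Binary.PropositionalEquality using (_≡_; refl; cong; cong₂)
open import Data.Product using (Σ; _×_; _,_)
open import Data.Sum using (_⊎_; inj₁; inj₂)

-- de Bruijn indices  n ::= 0 | S n
data Index : Set where
  O : Index
  S : Index → Index

data Term : Set where
  var : Index → Term
  lam : Term → Term
  app : Term → Term → Term

isize : Index → ℕ
isize O = 1
isize (S n) = suc (isize n)

size : Term → ℕ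
size (var n) = isize n
size (lam M) = suc (size M)
size (app M N) = suc (size M + size N)

data HasSubterm (M : Term) : Term → Set where
  here  : HasSubterm M M
  underλ : ∀ {N} → HasSubterm M N → HasSubterm M (lam N)
  appˡ  : ∀ {N₁ N₂} → HasSubterm M N₁ → HasSubterm M (app N₁ N₂)
  appʳ  : ∀ {N₁ N₂} → HasSubterm M N₂ → HasSubterm M (app N₁ N₂)

S-inj : ∀ {m n} → S m ≡ S n → m ≡ n
S-inj refl = refl

_≟ᵢ_ : (m n : Index) → Dec (m ≡ n)
O ≟ᵢ O = yes refl
O ≟ᵢ S n = no (λ ())
S m ≟ᵢ O = no (λ ())
S m ≟ᵢ S n with m ≟ᵢ n
... | yes refl = yes refl
... | no ne = no (λ e → ne (S-inj e))

var-inj : ∀ {m n} → var m ≡ var n → m ≡ n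
var-inj refl = refl
lam-inj : ∀ {M N} → lam M ≡ lam N → M ≡ N
lam-inj refl = refl
app-injˡ : ∀ {M₁ M₂ N₁ N₂} → app M₁ M₂ ≡ app N₁ N₂ → M₁ ≡ N₁
app-injˡ refl = refl
app-injʳ : ∀ {M₁ M₂ N₁ N₂} → app M₁ M₂ ≡ app N₁ N₂ → M₂ ≡ N₂
app-injʳ refl = refl

_≟_ : (M N : Term) → Dec (M ≡ N)
var m ≟ var n with m ≟ᵢ n
... | yes refl = yes refl
... | no ne = no (λ e → ne (var-inj e))
var m ≟ lam N = no (λ ())
var m ≟ app N N₁ = no (λ ())
lam M ≟ var n = no (λ ())
lam M ≟ lam N with M ≟ N
... | yes refl = yes refl
... | no ne = no (λ e → ne (lam-inj e))
lam M ≟ app N N₁ = no (λ ())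
app M M₁ ≟ var n = no (λ ())
app M M₁ ≟ lam N = no (λ ())
app M₁ M₂ ≟ app N₁ N₂ with M₁ ≟ N₁ | M₂ ≟ N₂
... | yes refl | yes refl = yes refl
... | no ne | _ = no (λ e → ne (app-injˡ e))
... | yes _ | no ne = no (λ e → ne (app-injʳ e))

hasSubterm? : (M N : Term) → Dec (HasSubterm M N)
hasSubterm? M N with M ≟ N
... | yes refl = yes here
hasSubterm? M (var n) | no ne = no λ { here → ne refl }
hasSubterm? M (lam N) | no ne with hasSubterm? M N
... | yes p = yes (underλ p)
... | no np = no λ { here → ne refl ; (underλ p) → np p }
hasSubterm? M (app N₁ N₂) | no ne with hasSubterm? M N₁ | hasSubterm? M N₂
... | yes p | _ = yes (appˡ p)
... | no _ | yes q = yes (appʳ q)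
... | no np | no nq = no λ { here → ne refl ; (appˡ p) → np p ; (appʳ q) → nq q }

idx : ℕ → Index
idx zero = O
idx (suc n) = S (idx n)

-- Given the lists of all terms of sizes 0..n (v at position i),
-- produce the list of all terms of size (suc n):
--   the variable of size suc n, λ M with |M| = n, and M₁ M₂ with |M₁| + |M₂| = n.
next : (n : ℕ) → Vec (List Term) (suc n) → List Term
next n v = var (idx n)
         ∷ (map lam (lookup v (fromℕ n))
         ++ concatMap (λ i → concatMap (λ a → map (app a) (lookup v (opposite i))) (lookup v i))
                      (allFin (suc n)))

table : (n : ℕ) → Vec (List Term) (suc n)
table zero = [] ∷v []v
table (suc n) = table n ∷ʳ next n (table n)

termsOfSize : ℕ → List Term
termsOfSize n = lookup (table n) (fromℕ n)

L : ℕ → ℕ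
L n = length (termsOfSize n)

A : Term → ℕ → ℕ
A M n = length (filter (hasSubterm? M) (termsOfSize n))

-- density of {terms having M as subterm} equals 1, i.e. A_n / L_n → 1.
-- Since A_n ≤ L_n, |A_n/L_n - 1| = (L_n - A_n)/L_n; the ε–N definition of the
-- limit with ε = 1/(k+1) (which suffices, ℚ being Archimedean) reads:
DensityOne : (ℕ → ℕ) → (ℕ → ℕ) → Set
DensityOne a l = ∀ (k : ℕ) → Σ ℕ λ N → ∀ n → N ≤ n → suc k * (l n ∸ a n) < l n

{-# OPTIONS --safe #-}
-- Let Aᶜ n count the terms of size n that avoid M, and m = size M. Splitting terms at the root gives
--   L (n + 1) = 1 + L n + Σᵢ L i · L (n − i)  and  Aᶜ (n + 1) ≤ 1 + Aᶜ n + Σᵢ Aᶜ i · Aᶜ (n − i),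
-- while Aᶜ m < L m because M does not avoid itself. If a · Aᶜ ≤ b · L from some point on, then the summand
-- i = m of the second sum falls short of the first by b · L (n − m), which is at least a fixed fraction 1/Q of
-- b · L (n + 1); this improves the bound to (2Q + 2) a · Aᶜ ≤ (2Q + 1) b · L further on. Iterating and
-- Bernoulli's inequality make Aᶜ n / L n eventually smaller than any 1/k.
-- The ratio bound L (n + 2) ≤ 12 · L (n + 1) behind Q = 12^(m+1) is a double count: a term of size n + 2 has at
-- least (n + 3)/3 nodes whose deletion (λ u ↦ u, S i ↦ i, 0 b ↦ λ b, a 0 ↦ λ a) leaves a term of size n + 1,
-- and the deleted node is recovered from the result, the position of the change and which of the four rules
-- was applied.
module Submission where

open import Defs
open import Data.Nat using (ℕ; zero; suc; _+_; _*_; _∸_; _^_; _≤_; _<_; _≤?_; z≤n; s≤s; z<s; NonZero)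
open import Data.Nat.Properties hiding (_≟_)
open import Algebra.Properties.CommutativeSemigroup +-commutativeSemigroup using () renaming (xy∙z≈xz∙y to +-rightComm)
open import Algebra.Properties.CommutativeSemigroup *-commutativeSemigroup using () renaming (x∙yz≈y∙xz to *-leftComm)
open import Data.Nat.ListAction using (sum)
open import Data.Nat.Solver using (module +-*-Solver)
open +-*-Solver using (solve; _:+_; _:*_; _:=_; con)
open import Data.Nat.Induction using (<-rec)
open import Data.Fin using (Fin; zero; suc; toℕ; fromℕ; fromℕ<; inject₁; opposite)
open import Data.Fin.Properties
  using (toℕ-injective; toℕ-fromℕ; toℕ-fromℕ<; toℕ-inject₁; toℕ≤pred[n]; opposite-prop; injective⇒≤)
open import Data.List
  using (List; []; _∷_; _++_; map; concatMap; length; filter; allFin; lookup; cartesianProduct; cartesianProductWith)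
open import Data.List.Properties using (length-++; length-map; map-cong; concatMap-cong; length-filter; filter-notAll)
open import Data.Vec as Vec using (Vec; []; _∷_; _∷ʳ_)
open import Data.List.Membership.Propositional using (_∈_)
open import Data.List.Membership.Propositional.Properties
  using (∈-map⁺; ∈-map⁻; ∈-++⁺ˡ; ∈-++⁺ʳ; ∈-++⁻; ∈-concatMap⁺; ∈-concatMap⁻; ∈-lookup; ∈-allFin; ∈-filter⁺; ∈-filter⁻
        ; ∈-cartesianProductWith⁺; ∈-cartesianProductWith⁻; ∈-cartesianProduct⁺)
open import Data.List.Relation.Binary.Subset.Propositional using (_⊆_)
open import Data.List.Relation.Binary.Disjoint.Propositional using (Disjoint)
open import Data.List.Relation.Unary.Any as Any using (here; there)
open import Data.List.Relation.Unary.Any.Properties using (lookup-index)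
import Data.List.Relation.Unary.All as All
import Data.List.Relation.Unary.All.Properties as All
import Data.List.Relation.Unary.AllPairs as AllPairs
open AllPairs using ([]; _∷_)
import Data.List.Relation.Unary.AllPairs.Properties as AllPairs
open import Data.List.Relation.Unary.Unique.Propositional using (Unique)
open import Data.List.Relation.Unary.Unique.Propositional.Properties as Unique using (concat⁺)
open import Data.Product as Product using (Σ; ∃-syntax; _×_; _,_; proj₁; proj₂)
open import Data.Maybe as Maybe using (Maybe; just; nothing)
open import Data.Maybe.Properties using (just-injective)
open import Data.Sum using (_⊎_; inj₁; inj₂)
open import Data.Empty using (⊥-elim)
open import Function using (_∘_)
open import Relation.Nullary using (¬_; Dec; yes; no; ¬?)
open import Relation.Binary.PropositionalEquality
  using (_≡_; _≢_; refl; sym; trans; cong; cong₂; subst; module ≡-Reasoning)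

private
  variable
    X Y Z : Set
    x : X
    xs ys zs : List X

length-concatMap : (f : X → List Y) (xs : List X) →
                   length (concatMap f xs) ≡ sum (map (length ∘ f) xs)
length-concatMap f []       = refl
length-concatMap f (x ∷ xs) =
  trans (length-++ (f x)) (cong (length (f x) +_) (length-concatMap f xs))

length-cartesianProductWith : (f : X → Y → Z) (xs : List X) (ys : List Y) →
                              length (cartesianProductWith f xs ys) ≡ length xs * length ys
length-cartesianProductWith f []       ys = refl
length-cartesianProductWith f (x ∷ xs) ys =
  trans (length-++ (map (f x) ys)) (cong₂ _+_ (length-map (f x) ys) (length-cartesianProductWith f xs ys))

sum-map-≤ : (f g : X → ℕ) (xs : List X) → (∀ {x} → x ∈ xs → f x ≤ g x) →
            sum (map f xs) ≤ sum (map g xs)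
sum-map-≤ f g []       f≤g = z≤n
sum-map-≤ f g (x ∷ xs) f≤g = +-mono-≤ (f≤g (here refl)) (sum-map-≤ f g xs (f≤g ∘ there))

sum-map-≤-with-slack : (f g : X → ℕ) {e : ℕ} → x ∈ xs → f x + e ≤ g x →
                       (∀ {y} → y ∈ xs → f y ≤ g y) → sum (map f xs) + e ≤ sum (map g xs)
sum-map-≤-with-slack {xs = y ∷ ys} f g {e} (here refl) slack f≤g = begin
  f y + sum (map f ys) + e   ≡⟨ +-rightComm (f y) _ e ⟩
  f y + e + sum (map f ys)   ≤⟨ +-mono-≤ slack (sum-map-≤ f g ys (f≤g ∘ there)) ⟩
  g y + sum (map g ys)       ∎
  where open ≤-Reasoning
sum-map-≤-with-slack {xs = y ∷ ys} f g {e} (there x∈ys) slack f≤g = begin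
  f y + sum (map f ys) + e   ≡⟨ +-assoc (f y) _ e ⟩
  f y + (sum (map f ys) + e)
    ≤⟨ +-mono-≤ (f≤g (here refl)) (sum-map-≤-with-slack f g x∈ys slack (f≤g ∘ there)) ⟩
  g y + sum (map g ys)       ∎
  where open ≤-Reasoning

sum-map-*ˡ : (c : ℕ) (f : X → ℕ) (xs : List X) → sum (map (λ x → c * f x) xs) ≡ c * sum (map f xs)
sum-map-*ˡ c f []       = sym (*-zeroʳ c)
sum-map-*ˡ c f (x ∷ xs) = trans (cong (c * f x +_) (sum-map-*ˡ c f xs)) (sym (*-distribˡ-+ c (f x) _))

sum-map-const : (c : ℕ) (xs : List X) → sum (map (λ _ → c) xs) ≡ length xs * c
sum-map-const c []       = refl
sum-map-const c (x ∷ xs) = cong (c +_) (sum-map-const c xs)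

length-filter+length-filter∁ : {P : X → Set} (P? : ∀ x → Dec (P x)) (xs : List X) →
  length (filter P? xs) + length (filter (¬? ∘ P?) xs) ≡ length xs
length-filter+length-filter∁ P? []       = refl
length-filter+length-filter∁ P? (x ∷ xs) with P? x
... | yes _ = cong suc (length-filter+length-filter∁ P? xs)
... | no  _ = trans (+-suc _ _) (cong suc (length-filter+length-filter∁ P? xs))

Unique⇒lookup-injective : Unique xs → ∀ i j → lookup xs i ≡ lookup xs j → i ≡ j
Unique⇒lookup-injective (_   ∷ _)  zero    zero    _  = refl
Unique⇒lookup-injective (x∉ ∷ _)  zero    (suc j) eq = ⊥-elim (All.lookup x∉ (∈-lookup j) eq)
Unique⇒lookup-injective (x∉ ∷ _)  (suc i) zero    eq = ⊥-elim (All.lookup x∉ (∈-lookup i) (sym eq))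
Unique⇒lookup-injective (_   ∷ u) (suc i) (suc j) eq = cong suc (Unique⇒lookup-injective u i j eq)

Unique∧⊆⇒length≤ : Unique xs → xs ⊆ ys → length xs ≤ length ys
Unique∧⊆⇒length≤ {xs = xs} {ys = ys} unique xs⊆ys = injective⇒≤ position-injective
  where
  position : Fin (length xs) → Fin (length ys)
  position i = Any.index (xs⊆ys (∈-lookup i))

  position-injective : ∀ {i j} → position i ≡ position j → i ≡ j
  position-injective {i} {j} eq = Unique⇒lookup-injective unique i j (begin
    lookup xs i                ≡⟨ lookup-index (xs⊆ys (∈-lookup i)) ⟩
    lookup ys (position i)     ≡⟨ cong (lookup ys) eq ⟩
    lookup ys (position j)     ≡⟨ lookup-index (xs⊆ys (∈-lookup j)) ⟨
    lookup xs j                ∎)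
    where open ≡-Reasoning

disjoint-map : {f : X → Z} {g : Y → Z} → (∀ {x y} → f x ≢ g y) → Disjoint (map f xs) (map g ys)
disjoint-map {f = f} {g} f≢g (v∈fxs , v∈gys) with ∈-map⁻ f v∈fxs | ∈-map⁻ g v∈gys
... | _ , _ , refl | _ , _ , eq = f≢g eq

disjoint-++ : ∀ ys → Disjoint xs ys → Disjoint xs zs → Disjoint xs (ys ++ zs)
disjoint-++ ys xs#ys xs#zs (v∈xs , v∈ys++zs) with ∈-++⁻ ys v∈ys++zs
... | inj₁ v∈ys = xs#ys (v∈xs , v∈ys)
... | inj₂ v∈zs = xs#zs (v∈xs , v∈zs)

unique-concatMap : (f : X → List Y) → (∀ x → Unique (f x)) →
                   (∀ {x y} → x ≢ y → Disjoint (f x) (f y)) → Unique xs → Unique (concatMap f xs)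
unique-concatMap f unique-f disjoint-f unique-xs =
  concat⁺ (All.map⁺ (All.universal unique-f _)) (AllPairs.map⁺ (AllPairs.map disjoint-f unique-xs))

Σ-list : {P : X → Set} → List X → ((x : X) → List (P x)) → List (Σ X P)
Σ-list xs f = concatMap (λ x → map (x ,_) (f x)) xs

module _ {P : X → Set} (f : (x : X) → List (P x)) where

  length-Σ-list : ∀ xs → length (Σ-list xs f) ≡ sum (map (length ∘ f) xs)
  length-Σ-list xs =
    trans (length-concatMap _ xs) (cong sum (map-cong (λ x → length-map {B = Σ X P} (x ,_) (f x)) xs))

  ∈-Σ-list⁺ : ∀ {x y} → x ∈ xs → y ∈ f x → (x , y) ∈ Σ-list xs f
  ∈-Σ-list⁺ x∈xs y∈fx = ∈-concatMap⁺ _ (Any.map (λ { refl → ∈-map⁺ _ y∈fx }) x∈xs)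

  ∈-Σ-list⁻ : ∀ {x y} → (x , y) ∈ Σ-list xs f → x ∈ xs
  ∈-Σ-list⁻ p = Any.map first (∈-concatMap⁻ _ p)
    where
    first : ∀ {x y x′} → (x , y) ∈ map (x′ ,_) (f x′) → x ≡ x′
    first p with ∈-map⁻ _ p
    ... | _ , _ , refl = refl

  unique-Σ-list : (∀ x → Unique (f x)) → Unique xs → Unique (Σ-list xs f)
  unique-Σ-list unique-f = unique-concatMap _ (λ x → Unique.map⁺ ,-injectiveʳ (unique-f x)) disjoint
    where
    ,-injectiveʳ : ∀ {x} {y y′ : P x} → (x , y) ≡ (x , y′) → y ≡ y′
    ,-injectiveʳ refl = refl
    disjoint : ∀ {x x′} → x ≢ x′ → Disjoint (map (x ,_) (f x)) (map (x′ ,_) (f x′))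
    disjoint x≢x′ (v∈ , v∈′) with ∈-map⁻ _ v∈ | ∈-map⁻ _ v∈′
    ... | _ , _ , refl | _ , _ , refl = x≢x′ refl

scaled-product-≤ : ∀ a x b y {u v} → a * x ≤ b * y → u ≤ v → a * (x * u) ≤ b * (y * v)
scaled-product-≤ a x b y {u} {v} ax≤by u≤v = begin
  a * (x * u) ≡⟨ *-assoc a x u ⟨
  a * x * u   ≤⟨ *-mono-≤ ax≤by u≤v ⟩
  b * y * v   ≡⟨ *-assoc b y v ⟩
  b * (y * v) ∎
  where open ≤-Reasoning

ratio-improvement : ∀ q {a X Y W} → X + Y ≤ a + W → W ≤ q * Y → (2 + (q + q)) * a ≤ W →
                    (2 + (q + q)) * X ≤ suc (q + q) * W
ratio-improvement q {a} {X} {Y} {W} X+Y≤a+W W≤qY Ta≤W = +-cancelʳ-≤ (W + W) _ _ (begin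
  T * X + (W + W)    ≤⟨ +-monoʳ-≤ (T * X) W+W≤TY ⟩
  T * X + T * Y      ≡⟨ *-distribˡ-+ T X Y ⟨
  T * (X + Y)        ≤⟨ *-monoʳ-≤ T X+Y≤a+W ⟩
  T * (a + W)        ≡⟨ *-distribˡ-+ T a W ⟩
  T * a + T * W      ≤⟨ +-monoˡ-≤ (T * W) Ta≤W ⟩
  W + (W + c * W)    ≡⟨ +-assoc W W (c * W) ⟨
  W + W + c * W      ≡⟨ +-comm (W + W) (c * W) ⟩
  c * W + (W + W)    ∎)
  where
  open ≤-Reasoning
  c = suc (q + q)
  T = suc c
  W+W≤TY : W + W ≤ T * Y
  W+W≤TY = begin
    W + W           ≤⟨ +-mono-≤ W≤qY W≤qY ⟩
    q * Y + q * Y   ≡⟨ *-distribʳ-+ Y q q ⟨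
    (q + q) * Y     ≤⟨ *-monoˡ-≤ Y (≤-trans (n≤1+n (q + q)) (n≤1+n _)) ⟩
    T * Y           ∎

bernoulli : ∀ c r → c ^ r * (c + r) ≤ suc c ^ r * c
bernoulli c zero    = ≤-reflexive (cong (_+ 0) (+-identityʳ c))
bernoulli c (suc r) = begin
  c * P * (c + suc r)
    ≡⟨ solve 3 (λ c P r → c :* P :* (c :+ (con 1 :+ r)) := c :* (P :* (c :+ r)) :+ c :* P) refl c P r ⟩
  c * (P * (c + r)) + c * P   ≤⟨ +-mono-≤ (*-monoʳ-≤ c (bernoulli c r)) cP≤Uc ⟩
  c * (U * c) + U * c         ≡⟨ solve 2 (λ c U → c :* (U :* c) :+ U :* c := (con 1 :+ c) :* U :* c) refl c U ⟩
  suc c * U * c               ∎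
  where
  open ≤-Reasoning
  P = c ^ r
  U = suc c ^ r
  cP≤Uc : c * P ≤ U * c
  cP≤Uc = ≤-trans (≤-reflexive (*-comm c P)) (≤-trans (*-monoʳ-≤ P (m≤m+n c r)) (bernoulli c r))

bernoulli-multiple : ∀ c k .{{_ : NonZero c}} → k * c ^ (k * c) ≤ suc c ^ (k * c)
bernoulli-multiple c k = *-cancelʳ-≤ _ _ c (begin
  k * P * c         ≡⟨ trans (*-assoc k P c) (*-leftComm k P c) ⟩
  P * (k * c)       ≤⟨ *-monoʳ-≤ P (m≤n+m (k * c) c) ⟩
  P * (c + k * c)   ≤⟨ bernoulli c (k * c) ⟩
  suc c ^ (k * c) * c ∎)
  where
  open ≤-Reasoning
  P = c ^ (k * c)

[1+k]*x≤y⇒k*x<y : ∀ k x {y} → suc k * x ≤ y → 0 < y → k * x < y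
[1+k]*x≤y⇒k*x<y k zero    {y} _    0<y = subst (_< y) (sym (*-zeroʳ k)) 0<y
[1+k]*x≤y⇒k*x<y k (suc x)     kx≤y _   = <-≤-trans (m<n+m (k * suc x) z<s) kx≤y

conv : (ℕ → ℕ) → ℕ → ℕ
conv f n = sum (map (λ i → f (toℕ i) * f (n ∸ toℕ i)) (allFin (suc n)))

module Negligible
  (L B : ℕ → ℕ) (R m : ℕ)
  (L-rec   : ∀ n → suc (L n + conv L n) ≤ L (suc n))
  (L-ratio : ∀ n → L (suc (suc n)) ≤ R * L (suc n))
  (B-rec   : ∀ n → B (suc n) ≤ suc (B n + conv B n))
  (B≤L     : ∀ n → B n ≤ L n)
  (B<L     : B m < L m)
  where

  n≤L : ∀ n → n ≤ L n
  n≤L zero    = z≤n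
  n≤L (suc n) = ≤-trans (s≤s (≤-trans (n≤L n) (m≤m+n (L n) (conv L n)))) (L-rec n)

  L-iterated-ratio : ∀ d j → L (suc (d + j)) ≤ R ^ d * L (suc j)
  L-iterated-ratio zero    j = ≤-reflexive (sym (*-identityˡ _))
  L-iterated-ratio (suc d) j = begin
    L (suc (suc (d + j)))    ≤⟨ L-ratio (d + j) ⟩
    R * L (suc (d + j))      ≤⟨ *-monoʳ-≤ R (L-iterated-ratio d j) ⟩
    R * (R ^ d * L (suc j))  ≡⟨ *-assoc R (R ^ d) _ ⟨
    R ^ suc d * L (suc j)    ∎
    where open ≤-Reasoning

  Q : ℕ
  Q = R ^ suc m

  L-lag : ∀ {n} → m < n → L (suc n) ≤ Q * L (n ∸ m)
  L-lag m<n with j , refl ← m≤n⇒∃[o]m+o≡n m<n =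
    subst (λ k → L (suc (suc m + j)) ≤ Q * L k) (sym n∸m≡1+j) (L-iterated-ratio (suc m) j)
    where
    n∸m≡1+j : suc m + j ∸ m ≡ suc j
    n∸m≡1+j = trans (cong (_∸ m) (sym (+-suc m j))) (m+n∸m≡n m (suc j))

  EventuallyBelow : ℕ → ℕ → Set
  EventuallyBelow a b = ∃[ J ] ∀ n → J ≤ n → a * B n ≤ b * L n

  module _ {a b J : ℕ} (below : ∀ n → J ≤ n → a * B n ≤ b * L n)
           {n : ℕ} (2J≤n : J + J ≤ n) (m+J≤n : m + J ≤ n) where

    -- One of i and n − i is at least J, and the term i = m gains b · L(n − m) because B m < L m.
    conv-defect : a * conv B n + b * L (n ∸ m) ≤ b * conv L n
    conv-defect = begin
      a * conv B n + b * L (n ∸ m)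
        ≡⟨ cong (_+ b * L (n ∸ m)) (sum-map-*ˡ a _ (allFin (suc n))) ⟨
      sum (map (λ i → a * (B (toℕ i) * B (n ∸ toℕ i))) (allFin (suc n))) + b * L (n ∸ m)
        ≤⟨ sum-map-≤-with-slack _ _ (∈-allFin m̂) slack (λ {i} _ → termwise (toℕ i)) ⟩
      sum (map (λ i → b * (L (toℕ i) * L (n ∸ toℕ i))) (allFin (suc n)))
        ≡⟨ sum-map-*ˡ b _ (allFin (suc n)) ⟩
      b * conv L n ∎
      where
      open ≤-Reasoning
      m<1+n : m < suc n
      m<1+n = s≤s (m+n≤o⇒m≤o m m+J≤n)
      m̂ : Fin (suc n)
      m̂ = fromℕ< m<1+n

      termwise : ∀ i → a * (B i * B (n ∸ i)) ≤ b * (L i * L (n ∸ i))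
      termwise i with J ≤? i
      ... | yes J≤i = scaled-product-≤ a (B i) b (L i) (below i J≤i) (B≤L (n ∸ i))
      ... | no  J≰i = begin
        a * (B i * B (n ∸ i))  ≡⟨ cong (a *_) (*-comm (B i) _) ⟩
        a * (B (n ∸ i) * B i)
          ≤⟨ scaled-product-≤ a (B (n ∸ i)) b (L (n ∸ i)) (below (n ∸ i) J≤n∸i) (B≤L i) ⟩
        b * (L (n ∸ i) * L i)  ≡⟨ cong (b *_) (*-comm _ (L i)) ⟩
        b * (L i * L (n ∸ i))  ∎
        where
        J≤n∸i : J ≤ n ∸ i
        J≤n∸i = m+n≤o⇒m≤o∸n J (≤-trans (+-monoʳ-≤ J (<⇒≤ (≰⇒> J≰i))) 2J≤n)

      k = n ∸ m

      slack : a * (B (toℕ m̂) * B (n ∸ toℕ m̂)) + b * L k ≤ b * (L (toℕ m̂) * L (n ∸ toℕ m̂))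
      slack rewrite toℕ-fromℕ< m<1+n = begin
        a * (B m * B k) + b * L k   ≡⟨ cong (_+ b * L k) (*-leftComm a (B m) (B k)) ⟩
        B m * (a * B k) + b * L k   ≤⟨ +-monoˡ-≤ (b * L k) (*-monoʳ-≤ (B m) (below k J≤k)) ⟩
        B m * (b * L k) + b * L k   ≡⟨ +-comm (B m * (b * L k)) (b * L k) ⟩
        suc (B m) * (b * L k)       ≤⟨ *-monoˡ-≤ (b * L k) B<L ⟩
        L m * (b * L k)             ≡⟨ *-leftComm (L m) b (L k) ⟩
        b * (L m * L k)             ∎
        where
        J≤k : J ≤ k
        J≤k = m+n≤o⇒m≤o∸n J (subst (_≤ n) (+-comm m J) m+J≤n)

    recurrence-defect : a * B (suc n) + b * L (n ∸ m) ≤ a + b * L (suc n)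
    recurrence-defect = begin
      a * B (suc n) + b * L (n ∸ m)                   ≤⟨ +-monoˡ-≤ _ (*-monoʳ-≤ a (B-rec n)) ⟩
      a * suc (B n + conv B n) + b * L (n ∸ m)
        ≡⟨ solve 4 (λ a x s y → a :* (con 1 :+ (x :+ s)) :+ y := a :+ (a :* x :+ (a :* s :+ y)))
                 refl a (B n) (conv B n) (b * L (n ∸ m)) ⟩
      a + (a * B n + (a * conv B n + b * L (n ∸ m)))  ≤⟨ +-monoʳ-≤ a (+-mono-≤ (below n J≤n) conv-defect) ⟩
      a + (b * L n + b * conv L n)                    ≡⟨ cong (a +_) (*-distribˡ-+ b (L n) _) ⟨
      a + b * (L n + conv L n)
        ≤⟨ +-monoʳ-≤ a (*-monoʳ-≤ b (≤-trans (n≤1+n _) (L-rec n))) ⟩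
      a + b * L (suc n)                               ∎
      where
      open ≤-Reasoning
      J≤n : J ≤ n
      J≤n = ≤-trans (m≤m+n J J) 2J≤n

  c : ℕ
  c = suc (Q + Q)

  step : ∀ {a b} .{{_ : NonZero b}} → EventuallyBelow a b → EventuallyBelow (suc c * a) (c * b)
  step {a} {b} (J , below) = suc K , below′
    where
    K = suc m + J + J + suc c * a

    below′ : ∀ n → suc K ≤ n → suc c * a * B n ≤ c * b * L n
    below′ (suc n) (s≤s K≤n) = begin
      suc c * a * B (suc n)    ≡⟨ *-assoc (suc c) a _ ⟩
      suc c * (a * B (suc n))  ≤⟨ ratio-improvement Q {a} {a * B (suc n)} {b * L (n ∸ m)} {b * L (suc n)}
                                      (recurrence-defect {a} {b} {J} below 2J≤n m+J≤n) lag small ⟩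
      c * (b * L (suc n))      ≡⟨ *-assoc c b _ ⟨
      c * b * L (suc n)        ∎
      where
      open ≤-Reasoning
      1+m+J+J≤n : suc m + J + J ≤ n
      1+m+J+J≤n = m+n≤o⇒m≤o _ K≤n
      1+m+J≤n : suc m + J ≤ n
      1+m+J≤n = m+n≤o⇒m≤o _ 1+m+J+J≤n
      m+J≤n : m + J ≤ n
      m+J≤n = <⇒≤ 1+m+J≤n
      2J≤n : J + J ≤ n
      2J≤n = ≤-trans (+-monoˡ-≤ J (m≤n+m J (suc m))) 1+m+J+J≤n
      lag : b * L (suc n) ≤ Q * (b * L (n ∸ m))
      lag = ≤-trans (*-monoʳ-≤ b (L-lag (m+n≤o⇒m≤o (suc m) 1+m+J≤n))) (≤-reflexive (*-leftComm b Q _))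
      small : suc c * a ≤ b * L (suc n)
      small = begin
        suc c * a      ≤⟨ m+n≤o⇒n≤o (suc m + J + J) K≤n ⟩
        n              ≤⟨ n≤1+n n ⟩
        suc n          ≤⟨ n≤L (suc n) ⟩
        L (suc n)      ≤⟨ m≤n*m (L (suc n)) b ⟩
        b * L (suc n)  ∎

  eventuallyBelow : ∀ r → EventuallyBelow (suc c ^ r) (c ^ r)
  eventuallyBelow zero    = 0 , λ n _ → *-monoʳ-≤ 1 (B≤L n)
  eventuallyBelow (suc r) = step {suc c ^ r} {c ^ r} {{m^n≢0 c r}} (eventuallyBelow r)

  negligible : ∀ k → ∃[ N ] ∀ n → N ≤ n → suc k * B n < L n
  negligible k = suc J , λ n J<n →
    [1+k]*x≤y⇒k*x<y (suc k) (B n) (bound n (<⇒≤ J<n)) (≤-trans (≤-trans z<s J<n) (n≤L n))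
    where
    r = suc (suc k) * c
    J = proj₁ (eventuallyBelow r)

    bound : ∀ n → J ≤ n → suc (suc k) * B n ≤ L n
    bound n J≤n = *-cancelˡ-≤ (c ^ r) {{m^n≢0 c r}} (begin
      c ^ r * (suc (suc k) * B n)   ≡⟨ *-leftComm (c ^ r) (suc (suc k)) (B n) ⟩
      suc (suc k) * (c ^ r * B n)   ≡⟨ *-assoc (suc (suc k)) (c ^ r) (B n) ⟨
      suc (suc k) * c ^ r * B n     ≤⟨ *-monoˡ-≤ (B n) (bernoulli-multiple c (suc (suc k))) ⟩
      suc c ^ r * B n               ≤⟨ proj₂ (eventuallyBelow r) n J≤n ⟩
      c ^ r * L n                   ∎)
      where open ≤-Reasoning

concatMap-map≡cartesianProductWith : (f : X → Y → Z) (xs : List X) (ys : List Y) →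
                                     concatMap (λ x → map (f x) ys) xs ≡ cartesianProductWith f xs ys
concatMap-map≡cartesianProductWith f []       ys = refl
concatMap-map≡cartesianProductWith f (x ∷ xs) ys =
  cong (map (f x) ys ++_) (concatMap-map≡cartesianProductWith f xs ys)

lookup-∷ʳ-inject₁ : ∀ {n} (xs : Vec X n) y (j : Fin n) → Vec.lookup (xs ∷ʳ y) (inject₁ j) ≡ Vec.lookup xs j
lookup-∷ʳ-inject₁ (x ∷ xs) y zero    = refl
lookup-∷ʳ-inject₁ (x ∷ xs) y (suc j) = lookup-∷ʳ-inject₁ xs y j

lookup-∷ʳ-fromℕ : ∀ {n} (xs : Vec X n) y → Vec.lookup (xs ∷ʳ y) (fromℕ n) ≡ y
lookup-∷ʳ-fromℕ []       y = refl
lookup-∷ʳ-fromℕ (x ∷ xs) y = lookup-∷ʳ-fromℕ xs y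

fromℕ-or-inject₁ : ∀ {n} (i : Fin (suc n)) → i ≡ fromℕ n ⊎ ∃[ j ] i ≡ inject₁ j
fromℕ-or-inject₁ {zero}  zero    = inj₁ refl
fromℕ-or-inject₁ {suc n} zero    = inj₂ (zero , refl)
fromℕ-or-inject₁ {suc n} (suc i) with fromℕ-or-inject₁ i
... | inj₁ refl       = inj₁ refl
... | inj₂ (j , refl) = inj₂ (suc j , refl)

lookup-table : ∀ n (i : Fin (suc n)) → Vec.lookup (table n) i ≡ termsOfSize (toℕ i)
lookup-table zero    zero = refl
lookup-table (suc n) i with fromℕ-or-inject₁ i
... | inj₁ refl       = cong termsOfSize (sym (toℕ-fromℕ (suc n)))
... | inj₂ (j , refl) = begin
  Vec.lookup (table n ∷ʳ next n (table n)) (inject₁ j) ≡⟨ lookup-∷ʳ-inject₁ (table n) _ j ⟩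
  Vec.lookup (table n) j                               ≡⟨ lookup-table n j ⟩
  termsOfSize (toℕ j)                                  ≡⟨ cong termsOfSize (toℕ-inject₁ j) ⟨
  termsOfSize (toℕ (inject₁ j))                        ∎
  where open ≡-Reasoning

applications : (ℕ → List Term) → (n : ℕ) → Fin (suc n) → List Term
applications T n i = cartesianProductWith app (T (toℕ i)) (T (n ∸ toℕ i))

compound : (ℕ → List Term) → ℕ → List Term
compound T n = map lam (T n) ++ concatMap (applications T n) (allFin (suc n))

level : (ℕ → List Term) → ℕ → List Term
level T n = var (idx n) ∷ compound T n

termsOfSize-suc : ∀ n → termsOfSize (suc n) ≡ level termsOfSize n
termsOfSize-suc n = trans (lookup-∷ʳ-fromℕ (table n) (next n (table n)))
  (cong (λ apps → var (idx n) ∷ (map lam (termsOfSize n) ++ apps))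
        (concatMap-cong table-applications (allFin (suc n))))
  where
  table-applications : ∀ i → concatMap (λ a → map (app a) (Vec.lookup (table n) (opposite i)))
                                       (Vec.lookup (table n) i)
                           ≡ applications termsOfSize n i
  table-applications i rewrite lookup-table n i | lookup-table n (opposite i) | opposite-prop i =
    concatMap-map≡cartesianProductWith app (termsOfSize (toℕ i)) (termsOfSize (n ∸ toℕ i))

data Compound (T : ℕ → List Term) (n : ℕ) : Term → Set where
  lam∈ : ∀ {u} → u ∈ T n → Compound T n (lam u)
  app∈ : ∀ {a b} (i : Fin (suc n)) → a ∈ T (toℕ i) → b ∈ T (n ∸ toℕ i) → Compound T n (app a b)

module _ (T : ℕ → List Term) (n : ℕ) where

  ∈-compound⁺ : ∀ {t} → Compound T n t → t ∈ compound T n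
  ∈-compound⁺ (lam∈ u∈) = ∈-++⁺ˡ (∈-map⁺ lam u∈)
  ∈-compound⁺ (app∈ i a∈ b∈) = ∈-++⁺ʳ (map lam (T n))
    (∈-concatMap⁺ (applications T n) (Any.map (λ { refl → ∈-cartesianProductWith⁺ app a∈ b∈ }) (∈-allFin i)))

  ∈-applications⁻ : ∀ {t} → t ∈ concatMap (applications T n) (allFin (suc n)) →
                    ∃[ i ] ∃[ a ] ∃[ b ] t ≡ app a b × a ∈ T (toℕ i) × b ∈ T (n ∸ toℕ i)
  ∈-applications⁻ t∈ with Any.satisfied (∈-concatMap⁻ (applications T n) {xs = allFin (suc n)} t∈)
  ... | i , t∈applications with ∈-cartesianProductWith⁻ app (T (toℕ i)) (T (n ∸ toℕ i)) t∈applications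
  ...   | a , b , a∈ , b∈ , t≡ab = i , a , b , t≡ab , a∈ , b∈

  ∈-compound⁻ : ∀ {t} → t ∈ compound T n → Compound T n t
  ∈-compound⁻ t∈ with ∈-++⁻ (map lam (T n)) t∈
  ... | inj₁ t∈lams with ∈-map⁻ lam t∈lams
  ...   | _ , u∈ , refl = lam∈ u∈
  ∈-compound⁻ t∈ | inj₂ t∈apps with ∈-applications⁻ t∈apps
  ...   | i , _ , _ , refl , a∈ , b∈ = app∈ i a∈ b∈

  length-level : length (level T n) ≡ suc (length (T n) + conv (length ∘ T) n)
  length-level = cong suc (begin
    length (compound T n)
      ≡⟨ length-++ (map lam (T n)) ⟩
    length (map lam (T n)) + length (concatMap (applications T n) (allFin (suc n)))
      ≡⟨ cong₂ _+_ (length-map lam (T n)) (length-concatMap (applications T n) (allFin (suc n))) ⟩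
    length (T n) + sum (map (length ∘ applications T n) (allFin (suc n)))
      ≡⟨ cong (λ s → length (T n) + sum s)
              (map-cong (λ i → length-cartesianProductWith app (T (toℕ i)) (T (n ∸ toℕ i))) (allFin (suc n))) ⟩
    length (T n) + conv (length ∘ T) n
      ∎)
    where open ≡-Reasoning

∈-termsOfSize-suc⁻ : ∀ {t n} → t ∈ termsOfSize (suc n) → t ≡ var (idx n) ⊎ Compound termsOfSize n t
∈-termsOfSize-suc⁻ {n = n} t∈ with subst (_ ∈_) (termsOfSize-suc n) t∈
... | here t≡var = inj₁ t≡var
... | there t∈   = inj₂ (∈-compound⁻ termsOfSize n t∈)

isize-idx : ∀ n → isize (idx n) ≡ suc n
isize-idx zero    = refl
isize-idx (suc n) = cong suc (isize-idx n)

idx-isize : ∀ i → idx (isize i) ≡ S i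
idx-isize O     = refl
idx-isize (S i) = cong S (idx-isize i)

∈-termsOfSize⁻ : ∀ t {n} → t ∈ termsOfSize n → size t ≡ n
∈-termsOfSize⁻ t {zero}  ()
∈-termsOfSize⁻ t {suc n} t∈ with ∈-termsOfSize-suc⁻ {n = n} t∈
... | inj₁ refl                    = isize-idx n
... | inj₂ (lam∈ {u} u∈)          = cong suc (∈-termsOfSize⁻ u {n} u∈)
... | inj₂ (app∈ {a} {b} i a∈ b∈) = cong suc (begin
  size a + size b         ≡⟨ cong₂ _+_ (∈-termsOfSize⁻ a {toℕ i} a∈) (∈-termsOfSize⁻ b {n ∸ toℕ i} b∈) ⟩
  toℕ i + (n ∸ toℕ i)     ≡⟨ m+[n∸m]≡n (toℕ≤pred[n] i) ⟩
  n                       ∎)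
  where open ≡-Reasoning

∈-termsOfSize⁺ : ∀ t → t ∈ termsOfSize (size t)
∈-termsOfSize⁺ (var O)     = here refl
∈-termsOfSize⁺ (var (S i)) rewrite termsOfSize-suc (isize i) | idx-isize i = here refl
∈-termsOfSize⁺ (lam u)     rewrite termsOfSize-suc (size u) =
  there (∈-compound⁺ termsOfSize (size u) (lam∈ (∈-termsOfSize⁺ u)))
∈-termsOfSize⁺ (app a b)   rewrite termsOfSize-suc (size a + size b) =
  there (∈-compound⁺ termsOfSize (size a + size b) (app∈ i a∈ b∈))
  where
  |a|<1+n : size a < suc (size a + size b)
  |a|<1+n = s≤s (m≤m+n (size a) (size b))
  i : Fin (suc (size a + size b))
  i = fromℕ< |a|<1+n
  i≡|a| : toℕ i ≡ size a
  i≡|a| = toℕ-fromℕ< |a|<1+n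
  a∈ : a ∈ termsOfSize (toℕ i)
  a∈ = subst (λ k → a ∈ termsOfSize k) (sym i≡|a|) (∈-termsOfSize⁺ a)
  b∈ : b ∈ termsOfSize (size a + size b ∸ toℕ i)
  b∈ = subst (λ k → b ∈ termsOfSize k)
             (sym (trans (cong (size a + size b ∸_) i≡|a|) (m+n∸m≡n (size a) (size b))))
             (∈-termsOfSize⁺ b)

unique-termsOfSize : ∀ n → Unique (termsOfSize n)
unique-termsOfSize = <-rec (Unique ∘ termsOfSize) unique-level
  where
  unique-level : ∀ n → (∀ {k} → k < n → Unique (termsOfSize k)) → Unique (termsOfSize n)
  unique-level zero    _      = []
  unique-level (suc n) unique<
    rewrite termsOfSize-suc n = All.tabulate var∉ ∷ Unique.++⁺ lams-unique apps-unique lams#apps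
    where
    unique≤ : ∀ (i : Fin (suc n)) → Unique (termsOfSize (toℕ i))
    unique≤ i = unique< (s≤s (toℕ≤pred[n] i))

    var∉ : ∀ {t} → t ∈ compound termsOfSize n → var (idx n) ≢ t
    var∉ t∈ with ∈-compound⁻ termsOfSize n t∈
    ... | lam∈ _     = λ ()
    ... | app∈ _ _ _ = λ ()

    lams-unique : Unique (map lam (termsOfSize n))
    lams-unique = Unique.map⁺ lam-inj (unique< ≤-refl)

    apps-unique : Unique (concatMap (applications termsOfSize n) (allFin (suc n)))
    apps-unique = unique-concatMap _ block-unique block-disjoint (Unique.allFin⁺ (suc n))
      where
      block-unique : ∀ i → Unique (applications termsOfSize n i)
      block-unique i = Unique.cartesianProductWith⁺ app (λ { refl → refl , refl })
                         (unique≤ i) (unique< (s≤s (m∸n≤m n (toℕ i))))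
      block-disjoint : ∀ {i j} → i ≢ j → Disjoint (applications termsOfSize n i) (applications termsOfSize n j)
      block-disjoint {i} {j} i≢j (t∈i , t∈j)
        with ∈-cartesianProductWith⁻ app (termsOfSize (toℕ i)) (termsOfSize (n ∸ toℕ i)) t∈i
           | ∈-cartesianProductWith⁻ app (termsOfSize (toℕ j)) (termsOfSize (n ∸ toℕ j)) t∈j
      ... | a , _ , a∈i , _ , refl | _ , _ , a∈j , _ , refl =
        i≢j (toℕ-injective (trans (sym (∈-termsOfSize⁻ a {toℕ i} a∈i)) (∈-termsOfSize⁻ a {toℕ j} a∈j)))

    lams#apps : Disjoint (map lam (termsOfSize n)) (concatMap (applications termsOfSize n) (allFin (suc n)))
    lams#apps (t∈lams , t∈apps) with ∈-map⁻ lam t∈lams | ∈-applications⁻ termsOfSize n t∈apps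
    ... | _ , _ , refl | _ , _ , _ , () , _

L-suc : ∀ n → L (suc n) ≡ suc (L n + conv L n)
L-suc n = trans (cong length (termsOfSize-suc n)) (length-level termsOfSize n)

module Avoiding (M : Term) where

  avoids? : (t : Term) → Dec (¬ HasSubterm M t)
  avoids? t = ¬? (hasSubterm? M t)

  avoiding : ℕ → List Term
  avoiding n = filter avoids? (termsOfSize n)

  Aᶜ : ℕ → ℕ
  Aᶜ n = length (avoiding n)

  L∸A≡Aᶜ : ∀ n → L n ∸ A M n ≡ Aᶜ n
  L∸A≡Aᶜ n = trans (cong (_∸ A M n) (sym (length-filter+length-filter∁ (hasSubterm? M) (termsOfSize n))))
                   (m+n∸m≡n (A M n) (Aᶜ n))

  Aᶜ≤L : ∀ n → Aᶜ n ≤ L n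
  Aᶜ≤L n = length-filter avoids? (termsOfSize n)

  Aᶜ<L : Aᶜ (size M) < L (size M)
  Aᶜ<L = filter-notAll avoids? (termsOfSize (size M))
           (Any.map (λ { refl avoids-M → avoids-M here }) (∈-termsOfSize⁺ M))

  avoiding-suc-⊆ : ∀ n → avoiding (suc n) ⊆ level avoiding n
  avoiding-suc-⊆ n t∈ with ∈-filter⁻ avoids? t∈
  ... | t∈E , avoids-t with ∈-termsOfSize-suc⁻ {n = n} t∈E
  ...   | inj₁ refl = here refl
  ...   | inj₂ (lam∈ u∈) = there (∈-compound⁺ avoiding n (lam∈ (∈-filter⁺ avoids? u∈ (avoids-t ∘ underλ))))
  ...   | inj₂ (app∈ i a∈ b∈) = there (∈-compound⁺ avoiding n
          (app∈ i (∈-filter⁺ avoids? a∈ (avoids-t ∘ appˡ)) (∈-filter⁺ avoids? b∈ (avoids-t ∘ appʳ))))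

  Aᶜ-suc : ∀ n → Aᶜ (suc n) ≤ suc (Aᶜ n + conv Aᶜ n)
  Aᶜ-suc n = begin
    Aᶜ (suc n)
      ≤⟨ Unique∧⊆⇒length≤ (Unique.filter⁺ avoids? (unique-termsOfSize (suc n))) (avoiding-suc-⊆ n) ⟩
    length (level avoiding n)    ≡⟨ length-level avoiding n ⟩
    suc (Aᶜ n + conv Aᶜ n)       ∎
    where open ≤-Reasoning

data Point : Term → Set where
  root : ∀ {t} → Point t
  inλ  : ∀ {u} → Point u → Point (lam u)
  inˡ  : ∀ {a b} → Point a → Point (app a b)
  inʳ  : ∀ {a b} → Point b → Point (app a b)
  inS  : ∀ {i} → Point (var i) → Point (var (S i))

mutual
  points : (t : Term) → List (Point t)
  points t = root ∷ pointsBelow t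

  pointsBelow : (t : Term) → List (Point t)
  pointsBelow (var O)     = []
  pointsBelow (var (S i)) = map inS (points (var i))
  pointsBelow (lam u)     = map inλ (points u)
  pointsBelow (app a b)   = map inˡ (points a) ++ map inʳ (points b)

∈-points : ∀ {t} (p : Point t) → p ∈ points t
∈-points root    = here refl
∈-points (inλ p) = there (∈-map⁺ inλ (∈-points p))
∈-points (inˡ p) = there (∈-++⁺ˡ (∈-map⁺ inˡ (∈-points p)))
∈-points (inʳ p) = there (∈-++⁺ʳ (map inˡ (points _)) (∈-map⁺ inʳ (∈-points p)))
∈-points (inS p) = there (∈-map⁺ inS (∈-points p))

length-points : ∀ t → length (points t) ≡ size t
length-points (var O)     = refl
length-points (var (S i)) = cong suc (trans (length-map inS (points (var i))) (length-points (var i)))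
length-points (lam u)     = cong suc (trans (length-map inλ (points u)) (length-points u))
length-points (app a b)   = cong suc (begin
  length (map inˡ (points a) ++ map inʳ (points b))       ≡⟨ length-++ (map inˡ (points a)) ⟩
  length (map inˡ (points a)) + length (map inʳ (points b))
    ≡⟨ cong₂ _+_ (trans (length-map inˡ (points a)) (length-points a))
                 (trans (length-map inʳ (points b)) (length-points b)) ⟩
  size a + size b                                         ∎)
  where open ≡-Reasoning

data Mark : Term → Set where
  λ-node : ∀ {u} → Mark (lam u)
  S-node : ∀ {i} → Mark (var (S i))
  0ˡ     : ∀ {a b} → a ≡ var O → Mark (app a b)
  0ʳ     : ∀ {a b} → b ≡ var O → Mark (app a b)
  inλ    : ∀ {u} → Mark u → Mark (lam u)
  inˡ    : ∀ {a b} → Mark a → Mark (app a b)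
  inʳ    : ∀ {a b} → Mark b → Mark (app a b)
  inS    : ∀ {i} → Mark (var i) → Mark (var (S i))

zeroProofs : (t : Term) → List (t ≡ var O)
zeroProofs t with t ≟ var O
... | yes t≡0 = t≡0 ∷ []
... | no  _   = []

marks : (t : Term) → List (Mark t)
marks (var O)     = []
marks (var (S i)) = S-node ∷ map inS (marks (var i))
marks (lam u)     = λ-node ∷ map inλ (marks u)
marks (app a b)   = map 0ˡ (zeroProofs a) ++ map 0ʳ (zeroProofs b) ++ map inˡ (marks a) ++ map inʳ (marks b)

unique-zeroProofs : ∀ t → Unique (zeroProofs t)
unique-zeroProofs t with t ≟ var O
... | yes _ = All.[] ∷ []
... | no  _ = []

length-zeroProofs≤1 : ∀ t → length (zeroProofs t) ≤ 1
length-zeroProofs≤1 t with t ≟ var O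
... | yes _ = ≤-refl
... | no  _ = z≤n

unique-marks : ∀ t → Unique (marks t)
unique-marks (var O)     = []
unique-marks (var (S i)) =
  All.map⁺ (All.universal (λ _ ()) _) ∷ Unique.map⁺ (λ { refl → refl }) (unique-marks (var i))
unique-marks (lam u)     =
  All.map⁺ (All.universal (λ _ ()) _) ∷ Unique.map⁺ (λ { refl → refl }) (unique-marks u)
unique-marks (app a b)   =
  Unique.++⁺ (Unique.map⁺ (λ { refl → refl }) (unique-zeroProofs a))
    (Unique.++⁺ (Unique.map⁺ (λ { refl → refl }) (unique-zeroProofs b))
      (Unique.++⁺ (Unique.map⁺ (λ { refl → refl }) (unique-marks a))
                  (Unique.map⁺ (λ { refl → refl }) (unique-marks b))
                  (disjoint-map (λ ())))
      (disjoint-++ below-left (disjoint-map (λ ())) (disjoint-map (λ ()))))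
    (disjoint-++ right-zero (disjoint-map (λ ()))
                 (disjoint-++ below-left (disjoint-map (λ ())) (disjoint-map (λ ()))))
  where
  right-zero = map 0ʳ (zeroProofs b)
  below-left = map inˡ (marks a)

marks-count-unary : ∀ {s m z} → suc s ≤ 3 * m + 2 * z → z ≤ 1 → suc (suc s) ≤ 3 * suc m + 2 * 0
marks-count-unary {s} {m} {z} s<3m+2z z≤1 = begin
  suc (suc s)          ≤⟨ s≤s s<3m+2z ⟩
  suc (3 * m + 2 * z)  ≤⟨ s≤s (+-monoʳ-≤ (3 * m) (*-monoʳ-≤ 2 z≤1)) ⟩
  suc (3 * m + 2 * 1)
    ≡⟨ solve 1 (λ m → con 1 :+ (con 3 :* m :+ con 2 :* con 1) := con 3 :* (con 1 :+ m) :+ con 2 :* con 0) refl m ⟩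
  3 * suc m + 2 * 0    ∎
  where open ≤-Reasoning

marks-count-binary : ∀ {s m z s′ m′ z′} → suc s ≤ 3 * m + 2 * z → suc s′ ≤ 3 * m′ + 2 * z′ →
                     suc (suc (s + s′)) ≤ 3 * (z + (z′ + (m + m′))) + 2 * 0
marks-count-binary {s} {m} {z} {s′} {m′} {z′} s<3m+2z s′<3m′+2z′ = begin
  suc (suc (s + s′))             ≡⟨ cong suc (+-suc s s′) ⟨
  suc s + suc s′                 ≤⟨ +-mono-≤ s<3m+2z s′<3m′+2z′ ⟩
  3 * m + 2 * z + (3 * m′ + 2 * z′)
    ≤⟨ +-mono-≤ (+-monoʳ-≤ (3 * m) (*-monoˡ-≤ z (n≤1+n 2)))
                (+-monoʳ-≤ (3 * m′) (*-monoˡ-≤ z′ (n≤1+n 2))) ⟩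
  3 * m + 3 * z + (3 * m′ + 3 * z′)
    ≡⟨ solve 4 (λ m z m′ z′ → con 3 :* m :+ con 3 :* z :+ (con 3 :* m′ :+ con 3 :* z′)
                           := con 3 :* (z :+ (z′ :+ (m :+ m′))) :+ con 2 :* con 0) refl m z m′ z′ ⟩
  3 * (z + (z′ + (m + m′))) + 2 * 0 ∎
  where open ≤-Reasoning

length-marks-app : ∀ a b → length (marks (app a b))
                         ≡ length (zeroProofs a) + (length (zeroProofs b) + (length (marks a) + length (marks b)))
length-marks-app a b =
  trans (length-++ (map 0ˡ (zeroProofs a)))
    (cong₂ _+_ (length-map 0ˡ (zeroProofs a))
      (trans (length-++ (map 0ʳ (zeroProofs b)))
        (cong₂ _+_ (length-map 0ʳ (zeroProofs b))
          (trans (length-++ (map inˡ (marks a)))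
                 (cong₂ _+_ (length-map inˡ (marks a)) (length-map inʳ (marks b)))))))

-- The slack 2 · [t ≡ var O] is paid for by the marks 0ˡ, 0ʳ of an application with a zero child.
marks-count : ∀ t → suc (size t) ≤ 3 * length (marks t) + 2 * length (zeroProofs t)
marks-count (var O)     = ≤-refl
marks-count (var (S i)) = begin
  suc (suc (isize i))
    ≤⟨ marks-count-unary (marks-count (var i)) (length-zeroProofs≤1 (var i)) ⟩
  3 * suc (length (marks (var i))) + 2 * 0
    ≡⟨ cong (λ k → 3 * suc k + 0) (length-map inS (marks (var i))) ⟨
  3 * length (marks (var (S i))) + 2 * 0
    ∎
  where open ≤-Reasoning
marks-count (lam u)     = begin
  suc (suc (size u))                  ≤⟨ marks-count-unary (marks-count u) (length-zeroProofs≤1 u) ⟩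
  3 * suc (length (marks u)) + 2 * 0  ≡⟨ cong (λ k → 3 * suc k + 0) (length-map inλ (marks u)) ⟨
  3 * length (marks (lam u)) + 2 * 0  ∎
  where open ≤-Reasoning
marks-count (app a b)   = begin
  suc (suc (size a + size b))
    ≤⟨ marks-count-binary {m = length (marks a)} {za} {m′ = length (marks b)} {zb} (marks-count a) (marks-count b) ⟩
  3 * (za + (zb + (length (marks a) + length (marks b)))) + 2 * 0
    ≡⟨ cong (λ k → 3 * k + 0) (length-marks-app a b) ⟨
  3 * length (marks (app a b)) + 2 * 0
    ∎
  where
  open ≤-Reasoning
  za = length (zeroProofs a)
  zb = length (zeroProofs b)

data Rule : Set where
  dropλ dropS 0ˡ↦λ 0ʳ↦λ : Rule

rules : List Rule
rules = dropλ ∷ dropS ∷ 0ˡ↦λ ∷ 0ʳ↦λ ∷ []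

∈-rules : ∀ r → r ∈ rules
∈-rules dropλ = here refl
∈-rules dropS = there (here refl)
∈-rules 0ˡ↦λ  = there (there (here refl))
∈-rules 0ʳ↦λ  = there (there (there (here refl)))

Pointed : Set
Pointed = Σ Term Point

Marked : Set
Marked = Σ Term Mark

-- Deleting any S-node of var (S i) gives var i; the mark at depth d is remembered as the point at depth d.
varPoint : ∀ {i} → Mark (var (S i)) → Point (var i)
varPoint       S-node  = root
varPoint {S i} (inS m) = inS (varPoint m)

varMark : ∀ {i} → Point (var i) → Mark (var (S i))
varMark root    = S-node
varMark (inS p) = inS (varMark p)

varMark-varPoint : ∀ {i} (m : Mark (var (S i))) → varMark (varPoint m) ≡ m
varMark-varPoint       S-node  = refl
varMark-varPoint {S i} (inS m) = cong inS (varMark-varPoint m)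

contract : (t : Term) → Mark t → Pointed × Rule
contract (var (S i)) m        = (var i , varPoint m) , dropS
contract (lam u)     λ-node   = (u , root) , dropλ
contract (app _ b)   (0ˡ refl) = (lam b , root) , 0ˡ↦λ
contract (app a _)   (0ʳ refl) = (lam a , root) , 0ʳ↦λ
contract (lam u)     (inλ m)  = Product.map₁ (λ (t , p) → lam t , inλ p) (contract u m)
contract (app a b)   (inˡ m)  = Product.map₁ (λ (t , p) → app t b , inˡ p) (contract a m)
contract (app a b)   (inʳ m)  = Product.map₁ (λ (t , p) → app a t , inʳ p) (contract b m)

expandRoot : Term → Rule → Maybe Marked
expandRoot t       dropλ = just (lam t , λ-node)
expandRoot (var i) dropS = just (var (S i) , S-node)
expandRoot (lam b) 0ˡ↦λ  = just (app (var O) b , 0ˡ refl)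
expandRoot (lam a) 0ʳ↦λ  = just (app a (var O) , 0ʳ refl)
expandRoot _       _     = nothing

expandAt : (t : Term) → Point t → Rule → Maybe Marked
expandAt t           root    r     = expandRoot t r
expandAt (var (S i)) (inS p) dropS = just (var (S (S i)) , inS (varMark p))
expandAt (var (S i)) (inS p) _     = nothing
expandAt (lam u)     (inλ p) r     = Maybe.map (λ (t , m) → lam t , inλ m) (expandAt u p r)
expandAt (app a b)   (inˡ p) r     = Maybe.map (λ (t , m) → app t b , inˡ m) (expandAt a p r)
expandAt (app a b)   (inʳ p) r     = Maybe.map (λ (t , m) → app a t , inʳ m) (expandAt b p r)

expand : Pointed × Rule → Maybe Marked
expand ((t , p) , r) = expandAt t p r

expand-contract : ∀ t (m : Mark t) → expand (contract t m) ≡ just (t , m)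
expand-contract (var (S i))     S-node    = refl
expand-contract (var (S (S i))) (inS m)   = cong (λ m → just (var (S (S i)) , inS m)) (varMark-varPoint m)
expand-contract (lam u)         λ-node    = refl
expand-contract (app _ b)       (0ˡ refl) = refl
expand-contract (app a _)       (0ʳ refl) = refl
expand-contract (lam u)         (inλ m)   = cong (Maybe.map _) (expand-contract u m)
expand-contract (app a b)       (inˡ m)   = cong (Maybe.map _) (expand-contract a m)
expand-contract (app a b)       (inʳ m)   = cong (Maybe.map _) (expand-contract b m)

contract-injective : ∀ {t t′} {m : Mark t} {m′ : Mark t′} →
                     contract t m ≡ contract t′ m′ → (t , m) ≡ (t′ , m′)
contract-injective {t} {t′} {m} {m′} eq =
  just-injective (trans (sym (expand-contract t m)) (trans (cong expand eq) (expand-contract t′ m′)))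

size-contract : ∀ t (m : Mark t) → suc (size (proj₁ (proj₁ (contract t m)))) ≡ size t
size-contract (var (S i)) m         = refl
size-contract (lam u)     λ-node    = refl
size-contract (app _ b)   (0ˡ refl) = refl
size-contract (app a _)   (0ʳ refl) = cong suc (+-comm 1 (size a))
size-contract (lam u)     (inλ m)   = cong suc (size-contract u m)
size-contract (app a b)   (inˡ m)   = cong (λ k → suc (k + size b)) (size-contract a m)
size-contract (app a b)   (inʳ m)   =
  cong suc (trans (sym (+-suc (size a) _)) (cong (size a +_) (size-contract b m)))

marked : ℕ → List Marked
marked n = Σ-list (termsOfSize n) marks

targets : ℕ → List (Pointed × Rule)
targets n = cartesianProduct (Σ-list (termsOfSize n) points) rules

zeroProofs-large : ∀ t → 1 < size t → zeroProofs t ≡ []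
zeroProofs-large (var O)     (s≤s ())
zeroProofs-large (var (S i)) _ = refl
zeroProofs-large (lam u)     _ = refl
zeroProofs-large (app a b)   _ = refl

length-marked : ∀ n → L (suc (suc n)) * suc (suc (suc n)) ≤ 3 * length (marked (suc (suc n)))
length-marked n = begin
  L (suc N) * suc (suc N)                     ≡⟨ sum-map-const (suc (suc N)) (termsOfSize (suc N)) ⟨
  sum (map (λ _ → suc (suc N)) (termsOfSize (suc N)))
    ≤⟨ sum-map-≤ _ _ (termsOfSize (suc N)) (λ {t} t∈ → enough-marks t (∈-termsOfSize⁻ t t∈)) ⟩
  sum (map (λ t → 3 * length (marks t)) (termsOfSize (suc N)))
    ≡⟨ sum-map-*ˡ 3 (length ∘ marks) (termsOfSize (suc N)) ⟩
  3 * sum (map (length ∘ marks) (termsOfSize (suc N)))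
    ≡⟨ cong (3 *_) (length-Σ-list marks (termsOfSize (suc N))) ⟨
  3 * length (marked (suc N))                 ∎
  where
  open ≤-Reasoning
  N = suc n
  enough-marks : ∀ t → size t ≡ suc N → suc (suc N) ≤ 3 * length (marks t)
  enough-marks t |t|≡ = begin
    suc (suc N)                                           ≡⟨ cong suc |t|≡ ⟨
    suc (size t)                                          ≤⟨ marks-count t ⟩
    3 * length (marks t) + 2 * length (zeroProofs t)
      ≡⟨ cong (λ zs → 3 * length (marks t) + 2 * length zs)
              (zeroProofs-large t (subst (1 <_) (sym |t|≡) (s≤s (s≤s z≤n)))) ⟩
    3 * length (marks t) + 0                              ≡⟨ +-identityʳ _ ⟩
    3 * length (marks t)                                  ∎

length-targets : ∀ n → length (targets n) ≤ L n * n * 4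
length-targets n = begin
  length (targets n)
    ≡⟨ length-cartesianProductWith _,_ (Σ-list (termsOfSize n) points) rules ⟩
  length (Σ-list (termsOfSize n) points) * 4               ≡⟨ cong (_* 4) (length-Σ-list points (termsOfSize n)) ⟩
  sum (map (length ∘ points) (termsOfSize n)) * 4
    ≤⟨ *-monoˡ-≤ 4 (sum-map-≤ (length ∘ points) (λ _ → n) (termsOfSize n)
                               (λ {t} t∈ → ≤-reflexive (trans (length-points t) (∈-termsOfSize⁻ t t∈)))) ⟩
  sum (map (λ _ → n) (termsOfSize n)) * 4                  ≡⟨ cong (_* 4) (sum-map-const n (termsOfSize n)) ⟩
  L n * n * 4                                              ∎
  where open ≤-Reasoning

contract-∈-targets : ∀ {n x} → x ∈ marked (suc n) → Product.uncurry contract x ∈ targets n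
contract-∈-targets {n} {t , m} x∈ = ∈-cartesianProduct⁺ (∈-Σ-list⁺ points t′∈ (∈-points _)) (∈-rules _)
  where
  t′ = proj₁ (proj₁ (contract t m))
  t′∈ : t′ ∈ termsOfSize n
  t′∈ = subst (λ k → t′ ∈ termsOfSize k)
          (suc-injective (trans (size-contract t m) (∈-termsOfSize⁻ t {suc n} (∈-Σ-list⁻ marks x∈))))
          (∈-termsOfSize⁺ t′)

L-ratio : ∀ n → L (suc (suc n)) ≤ 12 * L (suc n)
L-ratio n = *-cancelʳ-≤ _ _ (suc (suc N)) (begin
  L (suc N) * suc (suc N)                          ≤⟨ length-marked n ⟩
  3 * length (marked (suc N))
    ≡⟨ cong (3 *_) (length-map (Product.uncurry contract) (marked (suc N))) ⟨
  3 * length (map (Product.uncurry contract) (marked (suc N)))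
    ≤⟨ *-monoʳ-≤ 3 (Unique∧⊆⇒length≤ unique-contracted contracted-⊆) ⟩
  3 * length (targets N)                           ≤⟨ *-monoʳ-≤ 3 (length-targets N) ⟩
  3 * (L N * N * 4)
    ≡⟨ solve 2 (λ l n → con 3 :* (l :* n :* con 4) := con 12 :* l :* n) refl (L N) N ⟩
  12 * L N * N                                     ≤⟨ *-monoʳ-≤ (12 * L N) (≤-trans (n≤1+n N) (n≤1+n (suc N))) ⟩
  12 * L N * suc (suc N)                           ∎)
  where
  open ≤-Reasoning
  N = suc n
  unique-contracted : Unique (map (Product.uncurry contract) (marked (suc N)))
  unique-contracted =
    Unique.map⁺ contract-injective (unique-Σ-list marks unique-marks (unique-termsOfSize (suc N)))
  contracted-⊆ : map (Product.uncurry contract) (marked (suc N)) ⊆ targets N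
  contracted-⊆ y∈ with ∈-map⁻ _ y∈
  ... | x , x∈ , refl = contract-∈-targets {N} x∈

corollary1 : (M : Term) → DensityOne (A M) L
corollary1 M k = Product.map₂ (λ thin n N≤n → subst (λ b → suc k * b < L n) (sym (L∸A≡Aᶜ n)) (thin n N≤n))
                              (negligible k)
  where
  open Avoiding M
  open Negligible L Aᶜ 12 (size M) (λ n → ≤-reflexive (sym (L-suc n))) L-ratio Aᶜ-suc Aᶜ≤L Aᶜ<L
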